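{- For all integers $n\ge 22$, the $n\times n$ queen graph satisfies $c(\mathcal{Q}_n)=4$.
   Context: The $n\times n$ queen graph $\mathcal{Q}_n$ has vertex set $\{1,\dots,n\}^2$, with two distinct vertices adjacent iff they lie in the same row, the same column, or on a common diagonal (difference a nonzero multiple of $(1,0),(0,1),(1,1)$ or $(1,-1)$). Cops and robbers: cops are placed on vertices, then the robber chooses a vertex; players alternate turns, cops first, each moving along an edge or staying put; cops win if some cop occupies the robber's vertex after finitely many turns. The cop number $c(G)$ is the least number of cops that can always win. -}

module Defs where

open import Data.Nat using (ℕ; _+_; _<_)
open import Data.Fin using (Fin; toℕ)
open import Data.Product using (Σ; _×_; _,_)
open import Data.Sum using (_⊎_)
open import Relation.Nullary using (¬_)
open import Relation.Binary.PropositionalEquality using (_≡_)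

Move : {V : Set} → (V → V → Set) → V → V → Set
Move Adj x y = x ≡ y ⊎ Adj x y

Caught : {V : Set} {k : ℕ} → (Fin k → V) → V → Set
Caught {k = k} cs r = Σ (Fin k) λ i → cs i ≡ r

-- CopsWinFrom Adj k cs r : it is the cops' turn, cops at cs, robber at r,
-- and the cops can force capture in finitely many turns.
-- (Inductive = well-founded strategy tree: every play ends in capture
-- after finitely many turns.)
data CopsWinFrom {V : Set} (Adj : V → V → Set) (k : ℕ) : (Fin k → V) → V → Set where
  step : ∀ {cs r} (cs′ : Fin k → V) →
         (∀ i → Move Adj (cs i) (cs′ i)) →
         (Caught cs′ r ⊎
          (∀ r′ → Move Adj r r′ → Caught cs′ r′ ⊎ CopsWinFrom Adj k cs′ r′)) →
         CopsWinFrom Adj k cs r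

CopsWin : {V : Set} → (V → V → Set) → ℕ → Set
CopsWin {V} Adj k =
  Σ (Fin k → V) λ cs → ∀ r → Caught cs r ⊎ CopsWinFrom Adj k cs r

CopNumberIs : {V : Set} → (V → V → Set) → ℕ → Set
CopNumberIs Adj k = CopsWin Adj k × (∀ j → j < k → ¬ CopsWin Adj j)

-- Queen graph Q_n on {0..n-1}² (shift of {1..n}²): distinct vertices in the
-- same row, column, diagonal (a-c = b-d) or anti-diagonal (a-c = d-b).
QVertex : ℕ → Set
QVertex n = Fin n × Fin n

QueenAdj : (n : ℕ) → QVertex n → QVertex n → Set
QueenAdj n (a , b) (c , d) =
  ¬ ((a , b) ≡ (c , d)) ×
  (toℕ a ≡ toℕ c ⊎ toℕ b ≡ toℕ d ⊎
   toℕ a + toℕ d ≡ toℕ b + toℕ c ⊎ toℕ a + toℕ b ≡ toℕ c + toℕ d)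

module Submission where

-- Four cops win on any board: once the robber has chosen his square r, four cops step from two corners
-- onto the four lines through r, so wherever the robber moves he lands on a line held by a cop.
--
-- Three cops lose for n ≥ 22: the robber stays in the octagon 7 ≤ x + y ≤ 35, |x − y| ≤ 14 of the
-- 22 × 22 corner of the board, on a square no cop attacks.  A cop that does not attack r attacks at
-- most 3 squares of a given line ℓ through r (one on each of its own lines not parallel to ℓ); a cop on
-- another line through r attacks at most 2 squares of ℓ \ {r}, and at most 1 when that line and ℓ are
-- the row and the column of r and the candidate squares all lie on one side of r.  Unless the robber can
-- stay put, some cop is on a line through r; then at most three lines are occupied, and on some free
-- line the octagon squares outnumber the attacked ones, as an exhaustive check over the 372 squares of
-- the octagon confirms.

open import Defs
open import Data.Bool using (true; false)
open import Data.Empty using (⊥; ⊥-elim)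
open import Data.Fin using (Fin; zero; suc; toℕ; fromℕ; fromℕ<; _≟_)
open import Data.Fin.Properties using (toℕ-injective; toℕ<n; toℕ-fromℕ<; toℕ-fromℕ)
open import Data.List using (List; []; _∷_; map; filter; length; upTo; allFin; cartesianProduct; tabulate)
open import Data.List.Properties using (length-filter; filter-all; filter-none; filter-≐; map-∘)
open import Data.List.Membership.Propositional using (_∈_; _∉_; lose; find)
open import Data.List.Membership.Propositional.Properties
  using (∈-filter⁺; ∈-filter⁻; ∈-allFin; ∈-map⁺; ∈-cartesianProduct⁺; ∈-upTo⁺; ∈-tabulate⁺)
open import Data.List.Membership.DecPropositional (_≟_ {4}) using (_∈?_)
open import Data.List.Relation.Unary.All as All using (All; all?; _∷_)
open import Data.List.Relation.Unary.All.Properties using (¬All⇒Any¬; ¬Any⇒All¬; all-filter)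
import Data.List.Relation.Unary.All.Properties as All
open import Data.List.Relation.Unary.AllPairs using (_∷_)
open import Data.List.Relation.Unary.Any using (Any; any?; here; there; satisfied)
open import Data.List.Relation.Unary.Unique.Propositional using (Unique)
open import Data.List.Relation.Unary.Unique.Propositional.Properties
  using (filter⁺; map⁺; upTo⁺; cartesianProduct⁺)
open import Data.Nat
  using (ℕ; zero; suc; _+_; _*_; _∸_; _≤_; _<_; _≤′_; ≤′-refl; ≤′-step; _≤?_; _<?_; z≤n; s≤s; s≤s⁻¹; z<s)
open import Data.Nat.ListAction using (sum)
open import Data.Nat.Properties
  using ( module ≤-Reasoning; ≤-trans; ≤-<-trans; <-≤-trans; ≤-reflexive; ≤-refl; <⇒≤; <⇒≢; ≰⇒>; <-asym
        ; ≤⇒≤′; +-comm; +-suc; +-mono-≤; +-monoʳ-≤; +-monoʳ-<; +-cancelˡ-≡; +-cancelʳ-≡; +-cancelʳ-<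
        ; *-cancelˡ-≡; m≤n⇒m≤1+n; n≤1+n; m∸n≤m; ∸-monoˡ-≤; m+n∸n≡m; m∸n+n≡m)
  renaming (_≟_ to _≟ℕ_)
open import Data.Nat.Tactic.RingSolver using (solve-∀)
open import Data.Product using (_×_; _,_; proj₁; proj₂; ∃; ∃-syntax)
open import Data.Product.Properties using (≡-dec)
open import Data.Sum using (_⊎_; inj₁; inj₂; [_,_])
open import Data.Vec.Functional as Vector using (updateAt)
open import Data.Vec.Functional.Properties using (updateAt-updates; updateAt-minimal)
open import Function using (_∘_; const)
open import Relation.Nullary using (Dec; yes; no; does; ¬_; ¬?; _×-dec_; _⊎-dec_; contradiction)
import Relation.Nullary.Decidable as Dec
open import Relation.Unary using (Decidable; ∁; _∪_; _≐_)
open import Relation.Unary.Properties using (_∪?_)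
open import Relation.Binary.PropositionalEquality
  using (_≡_; _≢_; refl; sym; trans; cong; cong₂; subst; module ≡-Reasoning)

sum-map-mono : {A : Set} {f g : A → ℕ} (xs : List A) → (∀ {x} → x ∈ xs → f x ≤ g x) →
               sum (map f xs) ≤ sum (map g xs)
sum-map-mono []       _   = z≤n
sum-map-mono (x ∷ xs) f≤g = +-mono-≤ (f≤g (here refl)) (sum-map-mono xs (f≤g ∘ there))

sum-map-1≡length : {A : Set} (xs : List A) → sum (map (const 1) xs) ≡ length xs
sum-map-1≡length []       = refl
sum-map-1≡length (_ ∷ xs) = cong suc (sum-map-1≡length xs)

module _ {A : Set} where

  subsingleton-length≤1 : {xs : List A} → Unique xs → (∀ {x y} → x ∈ xs → y ∈ xs → x ≡ y) →
                          length xs ≤ 1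
  subsingleton-length≤1 {[]}        _               _    = z≤n
  subsingleton-length≤1 {_ ∷ []}    _               _    = s≤s z≤n
  subsingleton-length≤1 {_ ∷ _ ∷ _} ((x≢y ∷ _) ∷ _) same =
    contradiction (same (here refl) (there (here refl))) x≢y

  length-filter<⇒Any∁ : {P : A → Set} (P? : Decidable P) (xs : List A) →
                        length (filter P? xs) < length xs → Any (∁ P) xs
  length-filter<⇒Any∁ P? xs shorter with all? P? xs
  ... | yes all = contradiction (cong length (filter-all P? all)) (<⇒≢ shorter)
  ... | no ¬all = ¬All⇒Any¬ P? xs ¬all

  module _ {P : A → Set} (P? : Decidable P) where

    length-filter≤1 : {xs : List A} → Unique xs → (∀ {x y} → x ∈ xs → y ∈ xs → P x → P y → x ≡ y) →
                      length (filter P? xs) ≤ 1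
    length-filter≤1 {xs} unique same = subsingleton-length≤1 (filter⁺ P? unique) same′
      where
      same′ : ∀ {x y} → x ∈ filter P? xs → y ∈ filter P? xs → x ≡ y
      same′ x∈ y∈ with ∈-filter⁻ P? x∈ | ∈-filter⁻ P? y∈
      ... | x∈xs , px | y∈xs , py = same x∈xs y∈xs px py

    length-filter-mono : {Q : A → Set} (Q? : Decidable Q) {xs : List A} →
                         (∀ {x} → x ∈ xs → P x → Q x) → length (filter P? xs) ≤ length (filter Q? xs)
    length-filter-mono Q? {[]}     _   = z≤n
    length-filter-mono Q? {x ∷ xs} P⇒Q with P? x | Q? x | length-filter-mono Q? (P⇒Q ∘ there)
    ... | yes _  | yes _  | ih = s≤s ih
    ... | yes px | no ¬qx | _  = contradiction (P⇒Q (here refl) px) ¬qx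
    ... | no _   | yes _  | ih = m≤n⇒m≤1+n ih
    ... | no _   | no _   | ih = ih

    length-filter-∪ : {Q : A → Set} (Q? : Decidable Q) (xs : List A) →
                      length (filter (P? ∪? Q?) xs) ≤ length (filter P? xs) + length (filter Q? xs)
    length-filter-∪ Q? []       = z≤n
    length-filter-∪ Q? (x ∷ xs) with ih ← length-filter-∪ Q? xs | does (P? x) | does (Q? x)
    ... | true  | true  = s≤s (≤-trans ih (+-monoʳ-≤ _ (n≤1+n _)))
    ... | true  | false = s≤s ih
    ... | false | true  = ≤-trans (s≤s ih) (≤-reflexive (sym (+-suc (length (filter P? xs)) _)))
    ... | false | false = ih

  module _ {I : Set} {R : I → A → Set} (R? : ∀ i → Decidable (R i)) where

    private
      any-R? : (is : List I) → Decidable (λ x → Any (λ i → R i x) is)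
      any-R? is x = any? (λ i → R? i x) is

      hits : List I → List A → ℕ
      hits is xs = sum (map (λ i → length (filter (R? i) xs)) is)

    length-filter-any : ∀ is xs → length (filter (any-R? is) xs) ≤ hits is xs
    length-filter-any []       xs =
      ≤-reflexive (cong length (filter-none (any-R? []) (All.universal (λ _ ()) xs)))
    length-filter-any (i ∷ is) xs = begin
      length (filter (any-R? (i ∷ is)) xs)                       ≡⟨ cong length (filter-≐ _ _ split xs) ⟩
      length (filter (R? i ∪? any-R? is) xs)                     ≤⟨ length-filter-∪ (R? i) (any-R? is) xs ⟩
      length (filter (R? i) xs) + length (filter (any-R? is) xs) ≤⟨ +-monoʳ-≤ _ (length-filter-any is xs) ⟩
      hits (i ∷ is) xs                                           ∎
      where
      open ≤-Reasoning
      split : (λ x → Any (λ j → R j x) (i ∷ is)) ≐ (R i ∪ λ x → Any (λ j → R j x) is)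
      split = (λ { (here r) → inj₁ r ; (there a) → inj₂ a }) , [ here , there ]

    length-filter-covered : {P : A → Set} (P? : Decidable P) (is : List I) {xs : List A} → Unique xs →
                            (∀ {x} → x ∈ xs → P x → Any (λ i → R i x) is) →
                            (∀ {i} → i ∈ is → ∀ {x y} → x ∈ xs → y ∈ xs → R i x → R i y → x ≡ y) →
                            length (filter P? xs) ≤ length is
    length-filter-covered P? is {xs} unique cover same = begin
      length (filter P? xs)          ≤⟨ length-filter-mono P? (any-R? is) cover ⟩
      length (filter (any-R? is) xs) ≤⟨ length-filter-any is xs ⟩
      hits is xs                     ≤⟨ sum-map-mono is (λ i∈ → length-filter≤1 (R? _) unique (same i∈)) ⟩
      sum (map (const 1) is)         ≡⟨ sum-map-1≡length is ⟩
      length is                      ∎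
      where open ≤-Reasoning

    uncovered : ∀ is xs → hits is xs < length xs → Any (λ x → ¬ Any (λ i → R i x) is) xs
    uncovered is xs few = length-filter<⇒Any∁ (any-R? is) xs (≤-<-trans (length-filter-any is xs) few)

∃-∉ : {A : Set} → (∀ (x y : A) → Dec (x ≡ y)) → {xs : List A} (ys : List A) → Unique xs →
      length ys < length xs → Any (_∉ ys) xs
∃-∉ _≟ᴬ_ {xs} ys unique longer = uncovered (λ y x → x ≟ᴬ y) ys xs (≤-<-trans hits≤ longer)
  where
  open ≤-Reasoning
  hits≤ : sum (map (λ y → length (filter (_≟ᴬ y) xs)) ys) ≤ length ys
  hits≤ = begin
    sum (map (λ y → length (filter (_≟ᴬ y) xs)) ys)
      ≤⟨ sum-map-mono ys (λ _ → length-filter≤1 (_≟ᴬ _) unique λ _ _ x≡y z≡y → trans x≡y (sym z≡y)) ⟩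
    sum (map (const 1) ys) ≡⟨ sum-map-1≡length ys ⟩
    length ys              ∎

-- Cops and robbers on an arbitrary graph

module _ {V : Set} {Adj : V → V → Set} where

  capture : ∀ {k} (cs : Fin k → V) {r} i → Move Adj (cs i) r → CopsWinFrom Adj k cs r
  capture cs {r} i cs-i→r = step (updateAt cs i (const r)) moves (inj₁ (i , updateAt-updates i cs))
    where
    moves : ∀ j → Move Adj (cs j) (updateAt cs i (const r) j)
    moves j with j ≟ i
    ... | yes refl = subst (Move Adj (cs j)) (sym (updateAt-updates j cs)) cs-i→r
    ... | no j≢i   = inj₁ (sym (updateAt-minimal j i cs j≢i))

  private
    caught-suc : ∀ {k v} {cs : Fin k → V} {r} → Caught cs r → Caught (v Vector.∷ cs) r
    caught-suc (i , cs-i≡r) = suc i , cs-i≡r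

    idle-moves : ∀ {k v} {cs cs′ : Fin k → V} → (∀ i → Move Adj (cs i) (cs′ i)) →
                 ∀ i → Move Adj ((v Vector.∷ cs) i) ((v Vector.∷ cs′) i)
    idle-moves moves zero    = inj₁ refl
    idle-moves moves (suc i) = moves i

  CopsWinFrom-idle : ∀ {k cs r} v → CopsWinFrom Adj k cs r → CopsWinFrom Adj (suc k) (v Vector.∷ cs) r
  CopsWinFrom-idle v (step cs′ moves (inj₁ caught)) =
    step _ (idle-moves moves) (inj₁ (caught-suc caught))
  CopsWinFrom-idle v (step cs′ moves (inj₂ next)) =
    step _ (idle-moves moves) (inj₂ λ r′ m → reply (next r′ m))
    where
    reply : ∀ {r′} → Caught cs′ r′ ⊎ CopsWinFrom Adj _ cs′ r′ →
            Caught (v Vector.∷ cs′) r′ ⊎ CopsWinFrom Adj _ (v Vector.∷ cs′) r′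
    reply (inj₁ caught) = inj₁ (caught-suc caught)
    reply (inj₂ win)    = inj₂ (CopsWinFrom-idle v win)

  CopsWin-suc : ∀ {k} → V → CopsWin Adj k → CopsWin Adj (suc k)
  CopsWin-suc v (cs , win) =
    v Vector.∷ cs , λ r → [ inj₁ ∘ caught-suc , inj₂ ∘ CopsWinFrom-idle v ] (win r)

  CopsWin-mono : ∀ {j k} → V → j ≤ k → CopsWin Adj j → CopsWin Adj k
  CopsWin-mono v = go ∘ ≤⇒≤′
    where
    go : ∀ {j k} → j ≤′ k → CopsWin Adj j → CopsWin Adj k
    go ≤′-refl       win = win
    go (≤′-step j≤k) win = CopsWin-suc v (go j≤k win)

  unthreatened⇒unoccupied : ∀ {k} {cs cs′ : Fin k → V} {r} → (∀ i → ¬ Move Adj (cs i) r) →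
                            (∀ i → Move Adj (cs i) (cs′ i)) → ∀ i → cs′ i ≢ r
  unthreatened⇒unoccupied safe moves i cs′-i≡r = safe i (subst (Move Adj _) cs′-i≡r (moves i))

  module _ {k : ℕ} (Home : V → Set)
           (flee : ∀ (cs : Fin k → V) r → Home r → (∀ i → cs i ≢ r) →
                   ∃[ r′ ] Home r′ × Move Adj r r′ × (∀ i → ¬ Move Adj (cs i) r′))
           where

    robber-evades : ∀ cs r → Home r → (∀ i → ¬ Move Adj (cs i) r) → ¬ CopsWinFrom Adj k cs r
    robber-evades cs r home safe (step cs′ moves outcome)
      with flee cs′ r home (unthreatened⇒unoccupied safe moves)
    ... | r′ , home′ , r→r′ , safe′ with outcome
    ...   | inj₁ (i , cs′-i≡r) = unthreatened⇒unoccupied safe moves i cs′-i≡r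
    ...   | inj₂ next with next r′ r→r′
    ...     | inj₁ (i , cs′-i≡r′) = safe′ i (inj₁ cs′-i≡r′)
    ...     | inj₂ win            = robber-evades cs′ r′ home′ safe′ win

    -- The robber starts on the square he would flee to from an unoccupied home square.
    robber-wins : (∀ (cs : Fin k → V) → ∃[ r ] Home r × (∀ i → cs i ≢ r)) → ¬ CopsWin Adj k
    robber-wins start (cs , win) with start cs
    ... | r₀ , home₀ , free₀ with flee cs r₀ home₀ free₀
    ...   | r , home , _ , safe with win r
    ...     | inj₁ (i , cs-i≡r) = safe i (inj₁ cs-i≡r)
    ...     | inj₂ w            = robber-evades cs r home safe w

-- Lines of ℕ² and the queen graph

Point : Set
Point = ℕ × ℕ

Dir : Set
Dir = Fin 4

pattern col  = zero
pattern row  = suc zero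
pattern diag = suc (suc zero)
pattern anti = suc (suc (suc zero))

allDirs : List Dir
allDirs = allFin 4

OnLine : Dir → Point → Point → Set
OnLine col  (x , y) (u , v) = x ≡ u
OnLine row  (x , y) (u , v) = y ≡ v
OnLine diag (x , y) (u , v) = x + v ≡ y + u
OnLine anti (x , y) (u , v) = x + y ≡ u + v

onLine? : ∀ d p q → Dec (OnLine d p q)
onLine? col  (x , y) (u , v) = x ≟ℕ u
onLine? row  (x , y) (u , v) = y ≟ℕ v
onLine? diag (x , y) (u , v) = x + v ≟ℕ y + u
onLine? anti (x , y) (u , v) = x + y ≟ℕ u + v

OnLine-sym : ∀ d {p q} → OnLine d p q → OnLine d q p
OnLine-sym col  e = sym e
OnLine-sym row  e = sym e
OnLine-sym diag {x , y} {u , v} e = trans (+-comm u y) (trans (sym e) (+-comm x v))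
OnLine-sym anti e = sym e

OnLine-trans : ∀ d {p q s} → OnLine d p q → OnLine d q s → OnLine d p s
OnLine-trans col  e f = trans e f
OnLine-trans row  e f = trans e f
OnLine-trans diag {x , y} {u , v} {s , t} e f = +-cancelʳ-≡ (u + v) (x + t) (y + s) (begin
  x + t + (u + v)   ≡⟨ regroup x t u v ⟩
  (x + v) + (u + t) ≡⟨ cong₂ _+_ e f ⟩
  (y + u) + (v + s) ≡⟨ sym (regroup y s v u) ⟩
  y + s + (v + u)   ≡⟨ cong (y + s +_) (+-comm v u) ⟩
  y + s + (u + v)   ∎)
  where
  open ≡-Reasoning
  regroup : ∀ a b c d → a + b + (c + d) ≡ (a + d) + (c + b)
  regroup = solve-∀
OnLine-trans anti e f = trans e f

private
  module _ {x y u v : ℕ} where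

    col-diag : x ≡ u → x + v ≡ y + u → (x , y) ≡ (u , v)
    col-diag refl e = cong (x ,_) (sym (+-cancelˡ-≡ x _ _ (trans e (+-comm y x))))

    col-anti : x ≡ u → x + y ≡ u + v → (x , y) ≡ (u , v)
    col-anti refl e = cong (x ,_) (+-cancelˡ-≡ x _ _ e)

    row-diag : y ≡ v → x + v ≡ y + u → (x , y) ≡ (u , v)
    row-diag refl e = cong (_, y) (+-cancelʳ-≡ y _ _ (trans e (+-comm y u)))

    row-anti : y ≡ v → x + y ≡ u + v → (x , y) ≡ (u , v)
    row-anti refl e = cong (_, y) (+-cancelʳ-≡ y _ _ e)

    diag-anti : x + v ≡ y + u → x + y ≡ u + v → (x , y) ≡ (u , v)
    diag-anti e f = col-anti x≡u f
      where
      open ≡-Reasoning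
      regroup : ∀ a b c → (a + b) + (a + c) ≡ 2 * a + (c + b)
      regroup = solve-∀
      x≡u : x ≡ u
      x≡u = *-cancelˡ-≡ x u 2 (+-cancelʳ-≡ (y + v) _ _ (begin
        2 * x + (y + v)   ≡⟨ sym (regroup x v y) ⟩
        (x + v) + (x + y) ≡⟨ cong₂ _+_ e f ⟩
        (y + u) + (u + v) ≡⟨ cong (_+ (u + v)) (+-comm y u) ⟩
        (u + y) + (u + v) ≡⟨ regroup u y v ⟩
        2 * u + (v + y)   ≡⟨ cong (2 * u +_) (+-comm v y) ⟩
        2 * u + (y + v)   ∎))

lines-meet-once : ∀ {d e p q} → d ≢ e → OnLine d p q → OnLine e p q → p ≡ q
lines-meet-once {col}  {col}  d≢e _ _ = contradiction refl d≢e
lines-meet-once {row}  {row}  d≢e _ _ = contradiction refl d≢e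
lines-meet-once {diag} {diag} d≢e _ _ = contradiction refl d≢e
lines-meet-once {anti} {anti} d≢e _ _ = contradiction refl d≢e
lines-meet-once {col}  {row}  _ e f = cong₂ _,_ e f
lines-meet-once {row}  {col}  _ e f = cong₂ _,_ f e
lines-meet-once {col}  {diag} _ e f = col-diag e f
lines-meet-once {diag} {col}  _ e f = col-diag f e
lines-meet-once {col}  {anti} _ e f = col-anti e f
lines-meet-once {anti} {col}  _ e f = col-anti f e
lines-meet-once {row}  {diag} _ e f = row-diag e f
lines-meet-once {diag} {row}  _ e f = row-diag f e
lines-meet-once {row}  {anti} _ e f = row-anti e f
lines-meet-once {anti} {row}  _ e f = row-anti f e
lines-meet-once {diag} {anti} _ e f = diag-anti e f
lines-meet-once {anti} {diag} _ e f = diag-anti f e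

crossing-unique : ∀ {d L r p q q′} → d ≢ L → OnLine L r q → OnLine L r q′ → OnLine d p q → OnLine d p q′ →
                  q ≡ q′
crossing-unique {d} {L} d≢L r~q r~q′ p~q p~q′ =
  lines-meet-once d≢L (OnLine-trans d (OnLine-sym d p~q) p~q′) (OnLine-trans L (OnLine-sym L r~q) r~q′)

Attacks : Point → Point → Set
Attacks p q = ∃[ d ] OnLine d p q

attacks? : ∀ p q → Dec (Attacks p q)
attacks? p q =
  Dec.map′ satisfied (λ (d , e) → lose (∈-allFin d) e) (any? (λ d → onLine? d p q) allDirs)

InBoard : ℕ → Point → Set
InBoard n (x , y) = x < n × y < n

point : ∀ {n} → QVertex n → Point
point (a , b) = toℕ a , toℕ b

point-injective : ∀ {n} {u v : QVertex n} → point u ≡ point v → u ≡ v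
point-injective eq = cong₂ _,_ (toℕ-injective (cong proj₁ eq)) (toℕ-injective (cong proj₂ eq))

point-inBoard : ∀ {n} (v : QVertex n) → InBoard n (point v)
point-inBoard (a , b) = toℕ<n a , toℕ<n b

vertex : ∀ {n} p → InBoard n p → QVertex n
vertex (x , y) (x<n , y<n) = fromℕ< x<n , fromℕ< y<n

point-vertex : ∀ {n} p (p∈ : InBoard n p) → point (vertex p p∈) ≡ p
point-vertex (x , y) (x<n , y<n) = cong₂ _,_ (toℕ-fromℕ< x<n) (toℕ-fromℕ< y<n)

move⇒attacks : ∀ {n} {u v : QVertex n} → Move (QueenAdj n) u v → Attacks (point u) (point v)
move⇒attacks (inj₁ refl)                       = col , refl
move⇒attacks (inj₂ (_ , inj₁ e))               = col , e
move⇒attacks (inj₂ (_ , inj₂ (inj₁ e)))        = row , e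
move⇒attacks (inj₂ (_ , inj₂ (inj₂ (inj₁ e)))) = diag , e
move⇒attacks (inj₂ (_ , inj₂ (inj₂ (inj₂ e)))) = anti , e

attacks⇒move : ∀ {n} {u v : QVertex n} → Attacks (point u) (point v) → Move (QueenAdj n) u v
attacks⇒move {u = u} {v} (d , e) with ≡-dec _≟_ _≟_ u v
... | yes u≡v = inj₁ u≡v
... | no u≢v  = inj₂ (u≢v , adjacency d e)
  where
  adjacency : ∀ d → OnLine d (point u) (point v) → _
  adjacency col  e = inj₁ e
  adjacency row  e = inj₂ (inj₁ e)
  adjacency diag e = inj₂ (inj₂ (inj₁ e))
  adjacency anti e = inj₂ (inj₂ (inj₂ e))

-- Four cops win

module _ (m : ℕ) where

  -- The diagonal through a square meets row 0 or column 0, and its antidiagonal meets column 0 or row m.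
  corner : Dir → QVertex (suc m)
  corner anti = zero , fromℕ m
  corner _    = zero , zero

  guard : Dir → Point → Point
  guard col  (a , b) = a , 0
  guard row  (a , b) = 0 , b
  guard diag (a , b) with b ≤? a
  ... | yes _ = a ∸ b , 0
  ... | no _  = 0 , b ∸ a
  guard anti (a , b) with a + b ≤? m
  ... | yes _ = 0 , a + b
  ... | no _  = a + b ∸ m , m

  guard-correct : ∀ d r → InBoard (suc m) r →
                  InBoard (suc m) (guard d r) × Attacks (point (corner d)) (guard d r) × OnLine d (guard d r) r
  guard-correct col  (a , b) (a<n , _) = (a<n , z<s) , (row , refl) , refl
  guard-correct row  (a , b) (_ , b<n) = (z<s , b<n) , (col , refl) , refl
  guard-correct diag (a , b) (a<n , b<n) with b ≤? a
  ... | yes b≤a = (≤-<-trans (m∸n≤m a b) a<n , z<s) , (row , refl) , m∸n+n≡m b≤a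
  ... | no b≰a  = (z<s , ≤-<-trans (m∸n≤m b a) b<n) , (col , refl) , sym (m∸n+n≡m (<⇒≤ (≰⇒> b≰a)))
  guard-correct anti (a , b) (a<n , b<n) with a + b ≤? m
  ... | yes a+b≤m = (z<s , s≤s a+b≤m) , (col , refl) , refl
  ... | no a+b≰m  = (s≤s a+b∸m≤m , s≤s ≤-refl) , (row , toℕ-fromℕ m) , m∸n+n≡m (<⇒≤ (≰⇒> a+b≰m))
    where
    a+b∸m≤m : a + b ∸ m ≤ m
    a+b∸m≤m = begin
      a + b ∸ m ≤⟨ ∸-monoˡ-≤ m (+-monoʳ-≤ a (s≤s⁻¹ b<n)) ⟩
      a + m ∸ m ≡⟨ m+n∸n≡m a m ⟩
      a         ≤⟨ s≤s⁻¹ a<n ⟩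
      m         ∎
      where open ≤-Reasoning

  four-cops-win : CopsWin (QueenAdj (suc m)) 4
  four-cops-win =
    corner , λ r → inj₂ (step (guards r) (guards-reachable r) (inj₂ λ r′ r→r′ → inj₂ (hunt r r′ r→r′)))
    where
    guard-inBoard : ∀ r d → InBoard (suc m) (guard d (point r))
    guard-inBoard r d = proj₁ (guard-correct d (point r) (point-inBoard r))

    guards : QVertex (suc m) → Dir → QVertex (suc m)
    guards r d = vertex _ (guard-inBoard r d)

    point-guards : ∀ r d → point (guards r d) ≡ guard d (point r)
    point-guards r d = point-vertex _ (guard-inBoard r d)

    guards-reachable : ∀ r d → Move (QueenAdj (suc m)) (corner d) (guards r d)
    guards-reachable r d = attacks⇒move (subst (Attacks (point (corner d))) (sym (point-guards r d))
                                               (proj₁ (proj₂ (guard-correct d (point r) (point-inBoard r)))))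

    hunt : ∀ r r′ → Move (QueenAdj (suc m)) r r′ → CopsWinFrom (QueenAdj (suc m)) 4 (guards r) r′
    hunt r r′ r→r′ with move⇒attacks r→r′
    ... | d , r~r′ = capture (guards r) d (attacks⇒move (d , OnLine-trans d guard~r r~r′))
      where
      guard~r : OnLine d (point (guards r d)) (point r)
      guard~r = subst (λ g → OnLine d g (point r)) (sym (point-guards r d))
                      (proj₂ (proj₂ (guard-correct d (point r) (point-inBoard r))))

-- Three cops lose

data Status : Set where
  unaligned : Status
  aligned   : Dir → Status

StatusOf : Point → Point → Status → Set
StatusOf r p unaligned   = ¬ Attacks p r
StatusOf r p (aligned d) = OnLine d p r

classify : ∀ r p → ∃ (StatusOf r p)
classify r p with attacks? p r
... | yes (d , p~r) = aligned d , p~r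
... | no ¬p~r       = unaligned , ¬p~r

status : Point → Point → Status
status r p = proj₁ (classify r p)

statuses : List Status
statuses = unaligned ∷ map aligned allDirs

∈-statuses : ∀ s → s ∈ statuses
∈-statuses unaligned   = here refl
∈-statuses (aligned d) = there (∈-map⁺ aligned (∈-allFin d))

Exits : (Point → Set) → Point → Dir → List Point → Set
Exits Home r L cs = Unique cs × All (λ q → Home q × OnLine L r q × q ≢ r) cs

exit-onLine : ∀ {Home r L cs q} → Exits Home r L cs → q ∈ cs → OnLine L r q
exit-onLine (_ , valid) q∈ = proj₁ (proj₂ (All.lookup valid q∈))

exit-≢ : ∀ {Home r L cs q} → Exits Home r L cs → q ∈ cs → q ≢ r
exit-≢ (_ , valid) q∈ = proj₂ (proj₂ (All.lookup valid q∈))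

otherDirs : List Dir → List Dir
otherDirs ds = filter (λ d → ¬? (d ∈? ds)) allDirs

∈-otherDirs⁺ : ∀ {d ds} → d ∉ ds → d ∈ otherDirs ds
∈-otherDirs⁺ {d} {ds} = ∈-filter⁺ (λ d → ¬? (d ∈? ds)) (∈-allFin d)

∈-otherDirs⁻ : ∀ {d ds} → d ∈ otherDirs ds → d ∉ ds
∈-otherDirs⁻ {ds = ds} = proj₂ ∘ ∈-filter⁻ (λ d → ¬? (d ∈? ds))

attack-direction-unaligned : ∀ {d L r p q} → ¬ Attacks p r → OnLine L r q → OnLine d p q → d ≢ L
attack-direction-unaligned {L = L} ¬p~r r~q p~q refl = ¬p~r (L , OnLine-trans L p~q (OnLine-sym L r~q))

attack-direction-aligned : ∀ {d σ L r p q} → σ ≢ L → OnLine σ p r → p ≢ r → OnLine L r q → q ≢ r →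
                           OnLine d p q → d ≢ σ × d ≢ L
attack-direction-aligned {σ = σ} {L} σ≢L p~r p≢r r~q q≢r p~q =
  (λ { refl → q≢r (lines-meet-once σ≢L (OnLine-trans σ (OnLine-sym σ p~q) p~r) (OnLine-sym L r~q)) }) ,
  (λ { refl → p≢r (lines-meet-once σ≢L p~r (OnLine-trans L p~q (OnLine-sym L r~q))) })

attacked≤otherDirs : ∀ {Home r L cs p} ds → Exits Home r L cs → L ∈ ds →
                     (∀ {d q} → q ∈ cs → OnLine d p q → d ∉ ds) →
                     length (filter (attacks? p) cs) ≤ length (otherDirs ds)
attacked≤otherDirs {p = p} ds exits L∈ds blocked =
  length-filter-covered (λ d → onLine? d p) (attacks? p) (otherDirs ds) (proj₁ exits) cover once
  where
  cover : ∀ {q} → q ∈ _ → Attacks p q → Any (λ d → OnLine d p q) (otherDirs ds)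
  cover q∈ (d , p~q) = lose (∈-otherDirs⁺ (blocked q∈ p~q)) p~q
  once : ∀ {d} → d ∈ otherDirs ds → ∀ {q q′} → q ∈ _ → q′ ∈ _ → OnLine d p q → OnLine d p q′ → q ≡ q′
  once d∈ q∈ q′∈ =
    crossing-unique (λ { refl → ∈-otherDirs⁻ d∈ L∈ds }) (exit-onLine exits q∈) (exit-onLine exits q′∈)

Crosswise : Dir → Dir → Set
Crosswise σ L = σ ≡ row × L ≡ col ⊎ σ ≡ col × L ≡ row

crosswise? : ∀ σ L → Dec (Crosswise σ L)
crosswise? σ L = (σ ≟ row ×-dec L ≟ col) ⊎-dec (σ ≟ col ×-dec L ≟ row)

crosswise⇒≢ : ∀ {σ L} → Crosswise σ L → σ ≢ L
crosswise⇒≢ (inj₁ (refl , refl)) ()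
crosswise⇒≢ (inj₂ (refl , refl)) ()

crosswise-direction : ∀ {σ L d} → Crosswise σ L → d ≢ σ → d ≢ L → d ≡ diag ⊎ d ≡ anti
crosswise-direction {d = diag} _ _ _ = inj₁ refl
crosswise-direction {d = anti} _ _ _ = inj₂ refl
crosswise-direction {d = col} (inj₁ (refl , refl)) _ d≢L = contradiction refl d≢L
crosswise-direction {d = col} (inj₂ (refl , refl)) d≢σ _ = contradiction refl d≢σ
crosswise-direction {d = row} (inj₁ (refl , refl)) d≢σ _ = contradiction refl d≢σ
crosswise-direction {d = row} (inj₂ (refl , refl)) _ d≢L = contradiction refl d≢L

side : Dir → Point → ℕ
side col = proj₂
side _   = proj₁

OneSided : Dir → Point → List Point → Set
OneSided L r cs = All (λ q → side L r < side L q) cs ⊎ All (λ q → side L q < side L r) cs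

oneSided? : ∀ L r cs → Dec (OneSided L r cs)
oneSided? L r cs = all? (λ q → side L r <? side L q) cs ⊎-dec all? (λ q → side L q <? side L r) cs

SameSide : Dir → Point → Point → Point → Set
SameSide L r q q′ = side L r < side L q × side L r < side L q′ ⊎ side L q < side L r × side L q′ < side L r

oneSided⇒sameSide : ∀ {L r cs q q′} → OneSided L r cs → q ∈ cs → q′ ∈ cs → SameSide L r q q′
oneSided⇒sameSide (inj₁ above) q∈ q′∈ = inj₁ (All.lookup above q∈ , All.lookup above q′∈)
oneSided⇒sameSide (inj₂ below) q∈ q′∈ = inj₂ (All.lookup below q∈ , All.lookup below q′∈)

-- A cop at (x , b) on the row of r = (a , b) attacks the column of r above r along the diagonal only if
-- x < a, and along the antidiagonal only if a < x (and the other way round below r).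
private
  crossed : ∀ {x a b v v′} → x + v ≡ b + a → x + b ≡ a + v′ → ¬ (b < v × b < v′ ⊎ v < b × v′ < b)
  crossed {x} {a} {b} e f (inj₁ (b<v , b<v′)) = <-asym x<a a<x
    where
    x<a : x < a
    x<a = +-cancelʳ-< b x a (<-≤-trans (+-monoʳ-< x b<v) (≤-reflexive (trans e (+-comm b a))))
    a<x : a < x
    a<x = +-cancelʳ-< b a x (<-≤-trans (+-monoʳ-< a b<v′) (≤-reflexive (sym f)))
  crossed {x} {a} {b} e f (inj₂ (v<b , v′<b)) = <-asym x<a a<x
    where
    x<a : x < a
    x<a = +-cancelʳ-< b x a (≤-<-trans (≤-reflexive f) (+-monoʳ-< a v′<b))
    a<x : a < x
    a<x = +-cancelʳ-< b a x (≤-<-trans (≤-reflexive (trans (+-comm a b) (sym e))) (+-monoʳ-< x v<b))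

crosswise-opposite : ∀ {σ L r p q q′} → Crosswise σ L → OnLine σ p r → OnLine L r q → OnLine L r q′ →
                     SameSide L r q q′ → OnLine diag p q → OnLine anti p q′ → ⊥
crosswise-opposite {r = a , b} {x , y} {u , v} {u′ , v′} (inj₁ (refl , refl)) refl refl refl sides e f =
  crossed e f sides
crosswise-opposite {r = a , b} {x , y} {u , v} {u′ , v′} (inj₂ (refl , refl)) refl refl refl sides e f =
  crossed (sym e) (trans (+-comm y a) (trans f (+-comm u′ b))) sides

crosswise-attacked≤1 : ∀ {Home σ L r p cs} → Crosswise σ L → OnLine σ p r → p ≢ r → Exits Home r L cs →
                       OneSided L r cs → length (filter (attacks? p) cs) ≤ 1
crosswise-attacked≤1 {σ = σ} {L} {r} {p} {cs} cw p~r p≢r exits oneSided =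
  length-filter≤1 (attacks? p) (proj₁ exits) same
  where
  r~ : ∀ {q} → q ∈ cs → OnLine L r q
  r~ = exit-onLine exits

  direction : ∀ {d q} → q ∈ cs → OnLine d p q → (d ≡ diag ⊎ d ≡ anti) × d ≢ L
  direction q∈ p~q with attack-direction-aligned (crosswise⇒≢ cw) p~r p≢r (r~ q∈) (exit-≢ exits q∈) p~q
  ... | d≢σ , d≢L = crosswise-direction cw d≢σ d≢L , d≢L

  sameSide : ∀ {q q′} → q ∈ cs → q′ ∈ cs → SameSide L r q q′
  sameSide = oneSided⇒sameSide {L} {r} oneSided

  same : ∀ {q q′} → q ∈ cs → q′ ∈ cs → Attacks p q → Attacks p q′ → q ≡ q′
  same q∈ q′∈ (_ , p~q) (_ , p~q′) with direction q∈ p~q | direction q′∈ p~q′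
  ... | inj₁ refl , d≢L | inj₁ refl , _ = crossing-unique {p = p} d≢L (r~ q∈) (r~ q′∈) p~q p~q′
  ... | inj₂ refl , d≢L | inj₂ refl , _ = crossing-unique {p = p} d≢L (r~ q∈) (r~ q′∈) p~q p~q′
  ... | inj₁ refl , _   | inj₂ refl , _ =
    ⊥-elim (crosswise-opposite {σ} {L} {r} {p} cw p~r (r~ q∈) (r~ q′∈) (sameSide q∈ q′∈) p~q p~q′)
  ... | inj₂ refl , _   | inj₁ refl , _ =
    ⊥-elim (crosswise-opposite {σ} {L} {r} {p} cw p~r (r~ q′∈) (r~ q∈) (sameSide q′∈ q∈) p~q′ p~q)

attackBound : Point → Dir → List Point → Status → ℕ
attackBound r L cs unaligned = length (otherDirs (L ∷ []))
attackBound r L cs (aligned σ) with σ ≟ L | crosswise? σ L ×-dec oneSided? L r cs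
... | yes _ | _     = length cs
... | no _  | yes _ = 1
... | no _  | no _  = length (otherDirs (L ∷ σ ∷ []))

attacked≤attackBound : ∀ {Home r L cs p} s → Exits Home r L cs → p ≢ r → StatusOf r p s →
                       length (filter (attacks? p) cs) ≤ attackBound r L cs s
attacked≤attackBound {L = L} unaligned exits _ ¬p~r =
  attacked≤otherDirs (L ∷ []) exits (here refl)
    λ q∈ p~q → λ { (here d≡L) → attack-direction-unaligned ¬p~r (exit-onLine exits q∈) p~q d≡L }
attacked≤attackBound {r = r} {L} {cs} {p} (aligned σ) exits p≢r p~r
  with σ ≟ L | crosswise? σ L ×-dec oneSided? L r cs
... | yes refl | _                   = length-filter (attacks? p) cs
... | no σ≢L   | yes (cw , oneSided) = crosswise-attacked≤1 cw p~r p≢r exits oneSided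
... | no σ≢L   | no _                =
  attacked≤otherDirs (L ∷ σ ∷ []) exits (here refl) blocked
  where
  blocked : ∀ {d q} → q ∈ cs → OnLine d p q → d ∉ L ∷ σ ∷ []
  blocked q∈ p~q with attack-direction-aligned σ≢L p~r p≢r (exit-onLine exits q∈) (exit-≢ exits q∈) p~q
  ... | d≢σ , d≢L = λ { (here d≡L) → d≢L d≡L ; (there (here d≡σ)) → d≢σ d≡σ }

unaligned? : ∀ s → Dec (s ≡ unaligned)
unaligned? unaligned   = yes refl
unaligned? (aligned _) = no λ ()

Escapable : (Dir → List Point) → (Dir → Status → ℕ) → List Status → Set
Escapable exits bound ss =
  All (_≡ unaligned) ss ⊎ Any (λ L → sum (map (bound L) ss) < length (exits L)) allDirs

escapable? : ∀ exits bound ss → Dec (Escapable exits bound ss)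
escapable? exits bound ss =
  all? unaligned? ss ⊎-dec any? (λ L → sum (map (bound L) ss) <? length (exits L)) allDirs

escape : ∀ {Home r} exits bound → (∀ L → Exits Home r L (exits L)) →
         (∀ L s {p} → p ≢ r → StatusOf r p s → length (filter (attacks? p) (exits L)) ≤ bound L s) →
         Home r → ∀ ps → All (_≢ r) ps → Escapable exits bound (map (status r) ps) →
         ∃[ q ] Home q × Attacks r q × All (λ p → ¬ Attacks p q) ps
escape {r = r} _ _ _ _ home ps _ (inj₁ allUnaligned) =
  r , home , (col , refl) , All.map unaligned⇒¬attacks (All.map⁻ allUnaligned)
  where
  unaligned⇒¬attacks : ∀ {p} → status r p ≡ unaligned → ¬ Attacks p r
  unaligned⇒¬attacks {p} eq = subst (StatusOf r p) eq (proj₂ (classify r p))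
escape {r = r} exits bound valid bounded _ ps ps≢r (inj₂ someLine) with satisfied someLine
... | L , few with find (uncovered attacks? ps (exits L) (≤-<-trans attacked≤ few))
  where
  attacked≤ : sum (map (λ p → length (filter (attacks? p) (exits L))) ps) ≤
              sum (map (bound L) (map (status r) ps))
  attacked≤ = ≤-trans (sum-map-mono ps λ {p} p∈ → bounded L _ (All.lookup ps≢r p∈) (proj₂ (classify r p)))
                      (≤-reflexive (cong sum (map-∘ ps)))
... | q , q∈ , unattacked with All.lookup (proj₂ (valid L)) q∈
...   | home′ , r~q , _ = q , home′ , (L , r~q) , ¬Any⇒All¬ ps unattacked

Safe : (Dir → List Point) → (Dir → Status → ℕ) → Set
Safe exits bound = All (λ s₁ → All (λ s₂ → All (λ s₃ →
  Escapable exits bound (s₁ ∷ s₂ ∷ s₃ ∷ [])) statuses) statuses) statuses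

safe? : ∀ exits bound → Dec (Safe exits bound)
safe? exits bound = all? (λ s₁ → all? (λ s₂ → all? (λ s₃ →
  escapable? exits bound (s₁ ∷ s₂ ∷ s₃ ∷ [])) statuses) statuses) statuses

Safe⇒escapable : ∀ {exits bound} → Safe exits bound →
                 ∀ s₁ s₂ s₃ → Escapable exits bound (s₁ ∷ s₂ ∷ s₃ ∷ [])
Safe⇒escapable safe s₁ s₂ s₃ =
  All.lookup (All.lookup (All.lookup safe (∈-statuses s₁)) (∈-statuses s₂)) (∈-statuses s₃)

Octagon : Point → Set
Octagon (x , y) = x < 22 × y < 22 × 7 ≤ x + y × x + y ≤ 35 × x ≤ y + 14 × y ≤ x + 14

octagon? : Decidable Octagon
octagon? (x , y) = x <? 22 ×-dec y <? 22 ×-dec 7 ≤? x + y ×-dec x + y ≤? 35 ×-dec x ≤? y + 14 ×-dec y ≤? x + 14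

octagon : List Point
octagon = filter octagon? (cartesianProduct (upTo 22) (upTo 22))

octagon-unique : Unique octagon
octagon-unique = filter⁺ octagon? (cartesianProduct⁺ (upTo⁺ 22) (upTo⁺ 22))

∈-octagon⁺ : ∀ {p} → Octagon p → p ∈ octagon
∈-octagon⁺ p∈@(x<22 , y<22 , _) =
  ∈-filter⁺ octagon? (∈-cartesianProduct⁺ (∈-upTo⁺ x<22) (∈-upTo⁺ y<22)) p∈

∈-octagon⁻ : ∀ {p} → p ∈ octagon → Octagon p
∈-octagon⁻ = proj₂ ∘ ∈-filter⁻ octagon? {xs = cartesianProduct (upTo 22) (upTo 22)}

_≟ₚ_ : (p q : Point) → Dec (p ≡ q)
_≟ₚ_ = ≡-dec _≟ℕ_ _≟ℕ_

-- On the diagonals, truncated subtraction yields junk squares off the line; exits filters them out.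
along : Dir → Point → ℕ → Point
along col  (a , b) i = a , i
along row  (a , b) i = i , b
along diag (a , b) i = i , i + b ∸ a
along anti (a , b) i = i , a + b ∸ i

along-injective : ∀ L r {i j} → along L r i ≡ along L r j → i ≡ j
along-injective col  _ = cong proj₂
along-injective row  _ = cong proj₁
along-injective diag _ = cong proj₁
along-injective anti _ = cong proj₁

exit? : ∀ r L → Decidable (λ q → Octagon q × OnLine L r q × q ≢ r)
exit? r L q = octagon? q ×-dec onLine? L r q ×-dec ¬? (q ≟ₚ r)

exits : Point → Dir → List Point
exits r L = filter (exit? r L) (map (along L r) (upTo 22))

exits-valid : ∀ r L → Exits Octagon r L (exits r L)
exits-valid r L = filter⁺ (exit? r L) (map⁺ (along-injective L r) (upTo⁺ 22)) ,
                  all-filter (exit? r L) (map (along L r) (upTo 22))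

-- Tabulated functions: in the exhaustive check below their values are evaluated once and then shared.
memoDir : {A : Set} → (Dir → A) → Dir → A
memoDir f = pick (f col) (f row) (f diag) (f anti)
  where
  pick : _ → _ → _ → _ → Dir → _
  pick a _ _ _ col  = a
  pick _ b _ _ row  = b
  pick _ _ c _ diag = c
  pick _ _ _ d anti = d

memoDir-correct : ∀ {A : Set} (f : Dir → A) d → memoDir f d ≡ f d
memoDir-correct f col  = refl
memoDir-correct f row  = refl
memoDir-correct f diag = refl
memoDir-correct f anti = refl

memoStatus : {A : Set} → (Status → A) → Status → A
memoStatus f = pick (f unaligned) (memoDir (f ∘ aligned))
  where
  pick : _ → (Dir → _) → Status → _
  pick u _ unaligned   = u
  pick _ a (aligned d) = a d

memoStatus-correct : ∀ {A : Set} (f : Status → A) s → memoStatus f s ≡ f s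
memoStatus-correct f unaligned   = refl
memoStatus-correct f (aligned d) = memoDir-correct (f ∘ aligned) d

attackBounds : Point → (Dir → List Point) → Dir → Status → ℕ
attackBounds r exits = memoDir (λ L → memoStatus (attackBound r L (exits L)))

attackBounds-correct : ∀ r exits L s → attackBounds r exits L s ≡ attackBound r L (exits L) s
attackBounds-correct r exits L s =
  trans (cong (λ f → f s) (memoDir-correct (λ L → memoStatus (attackBound r L (exits L))) L))
        (memoStatus-correct (attackBound r L (exits L)) s)

decided : ∀ {A : Set} (a? : Dec A) → does a? ≡ true → A
decided (yes a) _ = a

octagon-safe : All (λ r → Safe (memoDir (exits r)) (attackBounds r (memoDir (exits r)))) octagon
octagon-safe = decided (all? (λ r → safeAt? r (memoDir (exits r))) octagon) refl
  where
  safeAt? : ∀ r exits → Dec (Safe exits (attackBounds r exits))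
  safeAt? r exits = safe? exits (attackBounds r exits)

octagon-escape : ∀ {r} → Octagon r → ∀ p₁ p₂ p₃ → All (_≢ r) (p₁ ∷ p₂ ∷ p₃ ∷ []) →
                 ∃[ q ] Octagon q × Attacks r q × All (λ p → ¬ Attacks p q) (p₁ ∷ p₂ ∷ p₃ ∷ [])
octagon-escape {r} r∈ p₁ p₂ p₃ ps≢r =
  escape exits′ (attackBounds r exits′) valid bounded r∈ (p₁ ∷ p₂ ∷ p₃ ∷ []) ps≢r
         (Safe⇒escapable {exits′} {attackBounds r exits′} (All.lookup octagon-safe (∈-octagon⁺ r∈)) _ _ _)
  where
  exits′ : Dir → List Point
  exits′ = memoDir (exits r)
  valid : ∀ L → Exits Octagon r L (exits′ L)
  valid L = subst (Exits Octagon r L) (sym (memoDir-correct (exits r) L)) (exits-valid r L)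
  bounded : ∀ L s {p} → p ≢ r → StatusOf r p s →
            length (filter (attacks? p) (exits′ L)) ≤ attackBounds r exits′ L s
  bounded L s p≢r st =
    subst (_ ≤_) (sym (attackBounds-correct r exits′ L s)) (attacked≤attackBound s (valid L) p≢r st)

module _ (n : ℕ) (22≤n : 22 ≤ n) where

  Home : QVertex n → Set
  Home v = Octagon (point v)

  octagon-vertex : ∀ {p} → Octagon p → ∃[ v ] Home v × point v ≡ p
  octagon-vertex {p} p∈@(x<22 , y<22 , _) = vertex p inBoard , subst Octagon (sym eq) p∈ , eq
    where
    inBoard : InBoard n p
    inBoard = <-≤-trans x<22 22≤n , <-≤-trans y<22 22≤n
    eq : point (vertex p inBoard) ≡ p
    eq = point-vertex p inBoard

  -- flee and start take their witnesses apart in helper functions: abstracting them with `with`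
  -- would normalise the witness terms, which is very slow here.
  flee : ∀ (cs : Fin 3 → QVertex n) r → Home r → (∀ i → cs i ≢ r) →
         ∃[ r′ ] Home r′ × Move (QueenAdj n) r r′ × (∀ i → ¬ Move (QueenAdj n) (cs i) r′)
  flee cs r r∈ free =
    relocate (octagon-escape r∈ _ _ _ (All.tabulate⁺ {f = point ∘ cs} (λ i → free i ∘ point-injective)))
    where
    relocate : ∃[ q ] Octagon q × Attacks (point r) q × All (λ p → ¬ Attacks p q) (tabulate (point ∘ cs)) →
               ∃[ r′ ] Home r′ × Move (QueenAdj n) r r′ × (∀ i → ¬ Move (QueenAdj n) (cs i) r′)
    relocate (q , q∈ , r~q , unattacked) with octagon-vertex q∈
    ... | r′ , r′∈ , refl =
      r′ , r′∈ , attacks⇒move r~q , λ i m → All.tabulate⁻ {f = point ∘ cs} unattacked i (move⇒attacks m)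

  start : ∀ (cs : Fin 3 → QVertex n) → ∃[ r ] Home r × (∀ i → cs i ≢ r)
  start cs =
    unoccupied (find (∃-∉ _≟ₚ_ (tabulate (point ∘ cs)) octagon-unique (decided (3 <? length octagon) refl)))
    where
    unoccupied : ∃[ p ] p ∈ octagon × p ∉ tabulate (point ∘ cs) → ∃[ r ] Home r × (∀ i → cs i ≢ r)
    unoccupied (p , p∈ , p∉) with octagon-vertex (∈-octagon⁻ p∈)
    ... | r , r∈ , refl = r , r∈ , λ i cs-i≡r →
      p∉ (subst (_∈ tabulate (point ∘ cs)) (cong point cs-i≡r) (∈-tabulate⁺ {f = point ∘ cs} i))

  three-cops-lose : ¬ CopsWin (QueenAdj n) 3
  three-cops-lose = robber-wins Home flee start

lemma3p5 : ∀ (n : ℕ) → 22 ≤ n → CopNumberIs (QueenAdj n) 4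
lemma3p5 (suc m) 22≤n =
  four-cops-win m , λ j j<4 win → three-cops-lose (suc m) 22≤n (CopsWin-mono (zero , zero) (s≤s⁻¹ j<4) win)
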